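{- Let $a,b,c$ be positive integers, let $\alpha=\frac{ab+\sqrt{a^2b^2+4abc}}{2}$ and $\beta=\frac{ab-\sqrt{a^2b^2+4abc}}{2}$, and let $\{v_n\}$ be defined by $v_0=2$, $v_1=b$, $v_n=av_{n-1}+cv_{n-2}$ for $n\ge2$ even and $v_n=bv_{n-1}+cv_{n-2}$ for $n\ge2$ odd. Then for integers $m,r>0$ and $z\in\{\alpha,\beta\}$, $$-(-abc)^{m+r}+a^{\frac{r+\xi(r)}{2}}b^{\frac{r-\xi(r)}{2}}v_r(-abc)^m z^r+z^{2(m+r)}=z^{m+2r}a^{\frac{m+\xi(m)}{2}}b^{\frac{m-\xi(m)}{2}}v_m.$$
   Context: $\xi(n)=n-2\lfloor n/2\rfloor$ is the parity function. -}

module Defs where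

open import Data.Nat as ℕ using (ℕ; zero; suc)
open import Data.Integer as ℤ using (ℤ; +_; -_)
open import Data.Product using (_×_; _,_)

ξ : ℕ → ℕ
ξ n = n ℕ.% 2

coef : ℤ → ℤ → ℕ → ℤ
coef a b n with ξ n
... | zero = a
... | suc _ = b

v : ℤ → ℤ → ℤ → ℕ → ℤ
v a b c zero = + 2
v a b c (suc zero) = b
v a b c (suc (suc n)) =
  coef a b (suc (suc n)) ℤ.* v a b c (suc n) ℤ.+ c ℤ.* v a b c n

-- The ring ℤ[α] where α = (ab + √(a²b²+4abc))/2 is a root of
-- X² = ab·X + abc.  An element (x , y) represents x + y·α.
-- (Concretely: ℤ[X]/(X² - abX - abc); it maps to ℝ by X ↦ α.)
Zα : Set
Zα = ℤ × ℤ

module Arith (a b c : ℤ) where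
  P Q : ℤ
  P = a ℤ.* b
  Q = a ℤ.* b ℤ.* c

  emb : ℤ → Zα
  emb x = x , + 0

  _⊕_ : Zα → Zα → Zα
  (x₁ , y₁) ⊕ (x₂ , y₂) = x₁ ℤ.+ x₂ , y₁ ℤ.+ y₂

  ⊖_ : Zα → Zα
  ⊖ (x , y) = ℤ.- x , ℤ.- y

  _⊗_ : Zα → Zα → Zα
  (x₁ , y₁) ⊗ (x₂ , y₂) =
    x₁ ℤ.* x₂ ℤ.+ Q ℤ.* (y₁ ℤ.* y₂) ,
    x₁ ℤ.* y₂ ℤ.+ x₂ ℤ.* y₁ ℤ.+ P ℤ.* (y₁ ℤ.* y₂)

  _⊛_ : Zα → ℕ → Zα
  z ⊛ zero = emb (+ 1)
  z ⊛ suc n = z ⊗ (z ⊛ n)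

  α β : Zα
  α = + 0 , + 1
  β = P , - (+ 1)

module Submission where

-- With P = ab and Q = abc, α and β are the roots of X² = PX + Q, so α + β = P and αβ = -Q = t.
-- The normalised sequence L n = a^⌈n/2⌉ b^⌊n/2⌋ v n satisfies L (n+2) = P L (n+1) + Q L n with
-- L 0 = 2 and L 1 = P: the weights absorb the alternation between the coefficients a and b.
-- Hence L n = α^n + β^n, and for z a root with conjugate z̄ the identity becomes
--   -(z z̄)^(m+r) + (z^r + z̄^r) (z z̄)^m z^r + z^(2(m+r)) = z^(m+2r) (z^m + z̄^m),
-- which holds for any two elements of a commutative ring, both sides being
-- z^(2m+2r) + z^(m+2r) z̄^m.

open import Defs
open import Algebra.Bundles using (CommutativeRing)
open import Algebra.Structures using (IsCommutativeRing)
open import Data.Nat as ℕ using (ℕ; zero; suc; z≤n; s≤s)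
open import Data.Nat.DivMod using (m/n≡1+[m∸n]/n; m%n≤m)
import Data.Nat.Properties as ℕ
open import Data.Product using (_×_; _,_; proj₁; proj₂; ∃)
open import Data.Sum using (_⊎_; inj₁; inj₂)
open import Level using (0ℓ)
open import Relation.Binary.PropositionalEquality as ≡
  using (_≡_; cong; cong₂; module ≡-Reasoning)

module PowerSums {c ℓ} (R : CommutativeRing c ℓ) where
  open CommutativeRing R
  open import Algebra.Properties.AbelianGroup +-abelianGroup using (\\-leftDividesʳ)
  open import Algebra.Properties.CommutativeSemigroup +-commutativeSemigroup using (interchange)
  open import Algebra.Properties.CommutativeSemiring.Exp commutativeSemiring
  open import Algebra.Solver.Ring.NaturalCoefficients.Default commutativeSemiring
    using (solve; _:=_; _:+_; _:*_)
  open import Relation.Binary.Reasoning.Setoid setoid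

  Recurrence : Carrier → Carrier → (ℕ → Carrier) → Set ℓ
  Recurrence p q f = ∀ n → f (suc (suc n)) ≈ p * f (suc n) + q * f n

  recurrence-unique : ∀ {p q f g} → Recurrence p q f → Recurrence p q g →
                      f 0 ≈ g 0 → f 1 ≈ g 1 → ∀ n → f n ≈ g n
  recurrence-unique {p} {q} {f} {g} rec-f rec-g f₀≈g₀ f₁≈g₁ n = proj₁ (consecutive n)
    where
    consecutive : ∀ n → f n ≈ g n × f (suc n) ≈ g (suc n)
    consecutive zero    = f₀≈g₀ , f₁≈g₁
    consecutive (suc n) =
      let fₙ≈gₙ , fₙ₊₁≈gₙ₊₁ = consecutive n
      in fₙ₊₁≈gₙ₊₁
       , trans (rec-f n) (trans (+-cong (*-congˡ fₙ₊₁≈gₙ₊₁) (*-congˡ fₙ≈gₙ)) (sym (rec-g n)))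

  +-recurrence : ∀ {p q f g} → Recurrence p q f → Recurrence p q g →
                 Recurrence p q (λ n → f n + g n)
  +-recurrence {p} {q} {f} {g} rec-f rec-g n = begin
    f (suc (suc n)) + g (suc (suc n))                     ≈⟨ +-cong (rec-f n) (rec-g n) ⟩
    (p * f (suc n) + q * f n) + (p * g (suc n) + q * g n) ≈⟨ interchange _ _ _ _ ⟩
    (p * f (suc n) + p * g (suc n)) + (q * f n + q * g n) ≈⟨ +-cong (distribˡ p _ _) (distribˡ q _ _) ⟨
    p * (f (suc n) + g (suc n)) + q * (f n + g n)         ∎

  vieta⇒root : ∀ {x y p q} → x + y ≈ p → x * y ≈ - q → x * x ≈ p * x + q
  vieta⇒root {x} {y} {p} {q} x+y≈p x*y≈-q = begin
    x * x               ≈⟨ +-identityʳ _ ⟨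
    x * x + 0#          ≈⟨ +-congˡ (-‿inverseˡ q) ⟨
    x * x + (- q + q)   ≈⟨ +-congˡ (+-congʳ x*y≈-q) ⟨
    x * x + (x * y + q) ≈⟨ +-assoc _ _ _ ⟨
    x * x + x * y + q   ≈⟨ +-congʳ (distribˡ x x y) ⟨
    x * (x + y) + q     ≈⟨ +-congʳ (trans (*-congˡ x+y≈p) (*-comm x p)) ⟩
    p * x + q           ∎

  root⇒power-recurrence : ∀ {x p q} → x * x ≈ p * x + q → Recurrence p q (x ^_)
  root⇒power-recurrence {x} {p} {q} x²≈px+q n = begin
    x * (x * x ^ n)             ≈⟨ *-assoc x x _ ⟨
    x * x * x ^ n               ≈⟨ *-congʳ x²≈px+q ⟩
    (p * x + q) * x ^ n         ≈⟨ distribʳ _ _ _ ⟩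
    p * x * x ^ n + q * x ^ n   ≈⟨ +-congʳ (*-assoc p x _) ⟩
    p * (x * x ^ n) + q * x ^ n ∎

  vieta⇒recurrence≈power-sum : ∀ {x y p q f} → x + y ≈ p → x * y ≈ - q →
                               Recurrence p q f → f 0 ≈ 1# + 1# → f 1 ≈ p →
                               ∀ n → f n ≈ x ^ n + y ^ n
  vieta⇒recurrence≈power-sum {x} {y} x+y≈p x*y≈-q rec-f f₀≈2 f₁≈p =
    recurrence-unique rec-f (+-recurrence (root⇒power-recurrence x-root) (root⇒power-recurrence y-root))
      f₀≈2 (trans f₁≈p (sym (trans (+-cong (*-identityʳ x) (*-identityʳ y)) x+y≈p)))
    where
    x-root = vieta⇒root x+y≈p x*y≈-q
    y-root = vieta⇒root (trans (+-comm y x) x+y≈p) (trans (*-comm y x) x*y≈-q)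

  ^-double : ∀ x k → x ^ (2 ℕ.* k) ≈ x ^ k * x ^ k
  ^-double x k = trans (^-homo-* x k (k ℕ.+ 0)) (*-congˡ (^-congʳ x (ℕ.+-identityʳ k)))

  power-sum-identity : ∀ x y m r →
    - ((x * y) ^ (m ℕ.+ r)) + (x ^ r + y ^ r) * (x * y) ^ m * x ^ r + x ^ (2 ℕ.* (m ℕ.+ r))
      ≈ x ^ (m ℕ.+ 2 ℕ.* r) * (x ^ m + y ^ m)
  power-sum-identity x y m r = begin
    - ((x * y) ^ (m ℕ.+ r)) + (x ^ r + y ^ r) * (x * y) ^ m * x ^ r + x ^ (2 ℕ.* (m ℕ.+ r))
      ≈⟨ +-cong (+-cong (-‿cong [xy]^[m+r]) (*-congʳ (*-congˡ (^-distrib-* x y m)))) x^[2m+2r] ⟩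
    - (X * U * (Y * V)) + (U + V) * (X * Y) * U + X * U * (X * U)
      ≈⟨ +-congʳ (+-congˡ (solve 4 (λ X Y U V → (U :+ V) :* (X :* Y) :* U
                                                := X :* U :* (Y :* V) :+ X :* Y :* (U :* U))
                                   refl X Y U V)) ⟩
    - (X * U * (Y * V)) + (X * U * (Y * V) + X * Y * (U * U)) + X * U * (X * U)
      ≈⟨ +-congʳ (\\-leftDividesʳ _ _) ⟩
    X * Y * (U * U) + X * U * (X * U)
      ≈⟨ solve 4 (λ X Y U V → X :* Y :* (U :* U) :+ X :* U :* (X :* U) := X :* (U :* U) :* (X :+ Y))
               refl X Y U V ⟩
    X * (U * U) * (X + Y)
      ≈⟨ *-congʳ (trans (^-homo-* x m (2 ℕ.* r)) (*-congˡ (^-double x r))) ⟨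
    x ^ (m ℕ.+ 2 ℕ.* r) * (x ^ m + y ^ m) ∎
    where
    X = x ^ m
    Y = y ^ m
    U = x ^ r
    V = y ^ r
    [xy]^[m+r] : (x * y) ^ (m ℕ.+ r) ≈ X * U * (Y * V)
    [xy]^[m+r] = trans (^-distrib-* x y (m ℕ.+ r)) (*-cong (^-homo-* x m r) (^-homo-* y m r))
    x^[2m+2r] : x ^ (2 ℕ.* (m ℕ.+ r)) ≈ X * U * (X * U)
    x^[2m+2r] = trans (^-double x (m ℕ.+ r)) (*-cong (^-homo-* x m r) (^-homo-* x m r))

open import Data.Integer as ℤ using (ℤ; +_; -_)
import Data.Integer.Properties as ℤ
open import Data.Integer.Solver using (module +-*-Solver)

module Zα-Ring (a b c : ℤ) where
  open Arith a b c
  open import Algebra.Consequences.Propositional {A = Zα}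
    using (comm∧idˡ⇒id; comm∧invˡ⇒inv; comm∧distrˡ⇒distrʳ)
  open import Algebra.Definitions {A = Zα} _≡_
  open +-*-Solver

  -- A copy of _⊗_ on solver polynomials, p and q standing for P and Q: a Zα identity then
  -- reduces, componentwise and by evaluation, to polynomial identities over ℤ.
  _⊗ₑ[_,_]_ : ∀ {n} → Polynomial n × Polynomial n → Polynomial n → Polynomial n →
              Polynomial n × Polynomial n → Polynomial n × Polynomial n
  (x₁ , y₁) ⊗ₑ[ p , q ] (x₂ , y₂) = x₁ :* x₂ :+ q :* (y₁ :* y₂) , x₁ :* y₂ :+ x₂ :* y₁ :+ p :* (y₁ :* y₂)

  ⊕-assoc : Associative _⊕_
  ⊕-assoc (x₁ , y₁) (x₂ , y₂) (x₃ , y₃) = cong₂ _,_ (ℤ.+-assoc x₁ x₂ x₃) (ℤ.+-assoc y₁ y₂ y₃)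

  ⊕-comm : Commutative _⊕_
  ⊕-comm (x₁ , y₁) (x₂ , y₂) = cong₂ _,_ (ℤ.+-comm x₁ x₂) (ℤ.+-comm y₁ y₂)

  ⊕-identityˡ : LeftIdentity (emb (+ 0)) _⊕_
  ⊕-identityˡ (x , y) = cong₂ _,_ (ℤ.+-identityˡ x) (ℤ.+-identityˡ y)

  ⊖-inverseˡ : LeftInverse (emb (+ 0)) ⊖_ _⊕_
  ⊖-inverseˡ (x , y) = cong₂ _,_ (ℤ.+-inverseˡ x) (ℤ.+-inverseˡ y)

  ⊗-assoc : Associative _⊗_
  ⊗-assoc (x₁ , y₁) (x₂ , y₂) (x₃ , y₃) = cong₂ _,_
    (solve 8 (λ p q x₁ y₁ x₂ y₂ x₃ y₃ →
        proj₁ (((x₁ , y₁) ⊗ₑ[ p , q ] (x₂ , y₂)) ⊗ₑ[ p , q ] (x₃ , y₃))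
     := proj₁ ((x₁ , y₁) ⊗ₑ[ p , q ] ((x₂ , y₂) ⊗ₑ[ p , q ] (x₃ , y₃))))
     ≡.refl P Q x₁ y₁ x₂ y₂ x₃ y₃)
    (solve 8 (λ p q x₁ y₁ x₂ y₂ x₃ y₃ →
        proj₂ (((x₁ , y₁) ⊗ₑ[ p , q ] (x₂ , y₂)) ⊗ₑ[ p , q ] (x₃ , y₃))
     := proj₂ ((x₁ , y₁) ⊗ₑ[ p , q ] ((x₂ , y₂) ⊗ₑ[ p , q ] (x₃ , y₃))))
     ≡.refl P Q x₁ y₁ x₂ y₂ x₃ y₃)

  ⊗-comm : Commutative _⊗_
  ⊗-comm (x₁ , y₁) (x₂ , y₂) = cong₂ _,_
    (cong₂ ℤ._+_ (ℤ.*-comm x₁ x₂) (cong (Q ℤ.*_) (ℤ.*-comm y₁ y₂)))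
    (cong₂ ℤ._+_ (ℤ.+-comm (x₁ ℤ.* y₂) (x₂ ℤ.* y₁)) (cong (P ℤ.*_) (ℤ.*-comm y₁ y₂)))

  ⊗-identityˡ : LeftIdentity (emb (+ 1)) _⊗_
  ⊗-identityˡ (x , y) = cong₂ _,_
    (solve 4 (λ p q x y → proj₁ ((con (+ 1) , con (+ 0)) ⊗ₑ[ p , q ] (x , y)) := x) ≡.refl P Q x y)
    (solve 4 (λ p q x y → proj₂ ((con (+ 1) , con (+ 0)) ⊗ₑ[ p , q ] (x , y)) := y) ≡.refl P Q x y)

  ⊗-distribˡ-⊕ : _⊗_ DistributesOverˡ _⊕_
  ⊗-distribˡ-⊕ (x₁ , y₁) (x₂ , y₂) (x₃ , y₃) = cong₂ _,_
    (solve 8 (λ p q x₁ y₁ x₂ y₂ x₃ y₃ →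
        proj₁ ((x₁ , y₁) ⊗ₑ[ p , q ] (x₂ :+ x₃ , y₂ :+ y₃))
     := proj₁ ((x₁ , y₁) ⊗ₑ[ p , q ] (x₂ , y₂)) :+ proj₁ ((x₁ , y₁) ⊗ₑ[ p , q ] (x₃ , y₃)))
     ≡.refl P Q x₁ y₁ x₂ y₂ x₃ y₃)
    (solve 8 (λ p q x₁ y₁ x₂ y₂ x₃ y₃ →
        proj₂ ((x₁ , y₁) ⊗ₑ[ p , q ] (x₂ :+ x₃ , y₂ :+ y₃))
     := proj₂ ((x₁ , y₁) ⊗ₑ[ p , q ] (x₂ , y₂)) :+ proj₂ ((x₁ , y₁) ⊗ₑ[ p , q ] (x₃ , y₃)))
     ≡.refl P Q x₁ y₁ x₂ y₂ x₃ y₃)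

  isCommutativeRing : IsCommutativeRing _≡_ _⊕_ _⊗_ ⊖_ (emb (+ 0)) (emb (+ 1))
  isCommutativeRing = record
    { isRing = record
      { +-isAbelianGroup = record
        { isGroup = record
          { isMonoid = record
            { isSemigroup = record
              { isMagma = record { isEquivalence = ≡.isEquivalence ; ∙-cong = cong₂ _⊕_ }
              ; assoc = ⊕-assoc
              }
            ; identity = comm∧idˡ⇒id ⊕-comm ⊕-identityˡ
            }
          ; inverse = comm∧invˡ⇒inv ⊕-comm ⊖-inverseˡ
          ; ⁻¹-cong = cong ⊖_
          }
        ; comm = ⊕-comm
        }
      ; *-cong = cong₂ _⊗_
      ; *-assoc = ⊗-assoc
      ; *-identity = comm∧idˡ⇒id ⊗-comm ⊗-identityˡ
      ; distrib = ⊗-distribˡ-⊕ , comm∧distrˡ⇒distrʳ ⊗-comm ⊗-distribˡ-⊕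
      }
    ; *-comm = ⊗-comm
    }

  commutativeRing : CommutativeRing 0ℓ 0ℓ
  commutativeRing = record { isCommutativeRing = isCommutativeRing }

  open import Algebra.Properties.CommutativeSemiring.Exp
    (CommutativeRing.commutativeSemiring commutativeRing) using (_^_) public

  ⊛≡^ : ∀ z n → z ⊛ n ≡ z ^ n
  ⊛≡^ z zero    = ≡.refl
  ⊛≡^ z (suc n) = cong (z ⊗_) (⊛≡^ z n)

  emb-* : ∀ x y → emb (x ℤ.* y) ≡ emb x ⊗ emb y
  emb-* x y = cong₂ _,_
    (solve 4 (λ p q x y → x :* y := proj₁ ((x , con (+ 0)) ⊗ₑ[ p , q ] (y , con (+ 0)))) ≡.refl P Q x y)
    (solve 4 (λ p q x y → con (+ 0) := proj₂ ((x , con (+ 0)) ⊗ₑ[ p , q ] (y , con (+ 0)))) ≡.refl P Q x y)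

  emb-^ : ∀ x n → emb (x ℤ.^ n) ≡ emb x ^ n
  emb-^ x zero    = ≡.refl
  emb-^ x (suc n) = ≡.trans (emb-* x (x ℤ.^ n)) (cong (emb x ⊗_) (emb-^ x n))

  α⊕β≡P : α ⊕ β ≡ emb P
  α⊕β≡P = cong (_, + 0) (ℤ.+-identityˡ P)

  α⊗β≡-Q : α ⊗ β ≡ emb (- Q)
  α⊗β≡-Q = cong₂ _,_
    (solve 2 (λ p q → proj₁ ((con (+ 0) , con (+ 1)) ⊗ₑ[ p , q ] (p , con (- + 1))) := :- q) ≡.refl P Q)
    (solve 2 (λ p q → proj₂ ((con (+ 0) , con (+ 1)) ⊗ₑ[ p , q ] (p , con (- + 1))) := con (+ 0)) ≡.refl P Q)

  conjugate : ∀ {z} → z ≡ α ⊎ z ≡ β → ∃ λ z̄ → z ⊕ z̄ ≡ emb P × z ⊗ z̄ ≡ emb (- Q)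
  conjugate (inj₁ ≡.refl) = β , α⊕β≡P , α⊗β≡-Q
  conjugate (inj₂ ≡.refl) = α , ≡.trans (⊕-comm β α) α⊕β≡P , ≡.trans (⊗-comm β α) α⊗β≡-Q

module Lucas (a b c : ℤ) where
  open Arith a b c
  open import Algebra.Properties.CommutativeSemigroup ℤ.*-commutativeSemigroup
    using (interchange; x∙yz≈y∙xz)
  open import Data.Integer.Tactic.RingSolver using (solve-∀)
  open ≡-Reasoning

  weight : ℕ → ℤ
  weight n = a ℤ.^ ((n ℕ.+ ξ n) ℕ./ 2) ℤ.* b ℤ.^ ((n ℕ.∸ ξ n) ℕ./ 2)

  lucas : ℕ → ℤ
  lucas n = weight n ℤ.* v a b c n

  [2+n]/2≡1+n/2 : ∀ n → (2 ℕ.+ n) ℕ./ 2 ≡ 1 ℕ.+ n ℕ./ 2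
  [2+n]/2≡1+n/2 n = m/n≡1+[m∸n]/n {2 ℕ.+ n} (s≤s (s≤s z≤n))

  weight-2+ : ∀ n → weight (2 ℕ.+ n) ≡ a ℤ.* b ℤ.* weight n
  weight-2+ n = begin
    a ℤ.^ ((2 ℕ.+ n ℕ.+ ξ n) ℕ./ 2) ℤ.* b ℤ.^ ((2 ℕ.+ n ℕ.∸ ξ n) ℕ./ 2)
      ≡⟨ cong₂ (λ i j → a ℤ.^ i ℤ.* b ℤ.^ j) ([2+n]/2≡1+n/2 (n ℕ.+ ξ n)) [2+n∸ξn]/2 ⟩
    a ℤ.* a ℤ.^ i ℤ.* (b ℤ.* b ℤ.^ j)
      ≡⟨ interchange a (a ℤ.^ i) b (b ℤ.^ j) ⟩
    a ℤ.* b ℤ.* weight n ∎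
    where
    i = (n ℕ.+ ξ n) ℕ./ 2
    j = (n ℕ.∸ ξ n) ℕ./ 2
    [2+n∸ξn]/2 : (2 ℕ.+ n ℕ.∸ ξ n) ℕ./ 2 ≡ 1 ℕ.+ j
    [2+n∸ξn]/2 = ≡.trans (cong (ℕ._/ 2) (ℕ.+-∸-assoc 2 (m%n≤m n 2))) ([2+n]/2≡1+n/2 (n ℕ.∸ ξ n))

  coef-weight : ∀ n → coef a b (2 ℕ.+ n) ℤ.* weight n ≡ weight (1 ℕ.+ n)
  coef-weight zero          = ≡.sym (ℤ.*-identityʳ _)
  coef-weight (suc zero)    = commute a b
    where
    commute : ∀ a b → b ℤ.* (a ℤ.* + 1 ℤ.* + 1) ≡ a ℤ.* + 1 ℤ.* (b ℤ.* + 1)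
    commute = solve-∀
  coef-weight (suc (suc n)) = begin
    C ℤ.* weight (2 ℕ.+ n)        ≡⟨ cong (C ℤ.*_) (weight-2+ n) ⟩
    C ℤ.* (a ℤ.* b ℤ.* weight n)  ≡⟨ x∙yz≈y∙xz C (a ℤ.* b) (weight n) ⟩
    a ℤ.* b ℤ.* (C ℤ.* weight n)  ≡⟨ cong (a ℤ.* b ℤ.*_) (coef-weight n) ⟩
    a ℤ.* b ℤ.* weight (1 ℕ.+ n)  ≡⟨ weight-2+ (1 ℕ.+ n) ⟨
    weight (3 ℕ.+ n)              ∎
    where
    C = coef a b (2 ℕ.+ n)

  lucas-1 : lucas 1 ≡ P
  lucas-1 = cong (ℤ._* b) (≡.trans (ℤ.*-identityʳ (a ℤ.* + 1)) (ℤ.*-identityʳ a))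

  lucas-recurrence : ∀ n → lucas (2 ℕ.+ n) ≡ P ℤ.* lucas (1 ℕ.+ n) ℤ.+ Q ℤ.* lucas n
  lucas-recurrence n = begin
    weight (2 ℕ.+ n) ℤ.* (C ℤ.* v₁ ℤ.+ c ℤ.* v₀)
      ≡⟨ cong (ℤ._* (C ℤ.* v₁ ℤ.+ c ℤ.* v₀)) (weight-2+ n) ⟩
    a ℤ.* b ℤ.* weight n ℤ.* (C ℤ.* v₁ ℤ.+ c ℤ.* v₀)
      ≡⟨ expand a b c (weight n) C v₁ v₀ ⟩
    a ℤ.* b ℤ.* (C ℤ.* weight n ℤ.* v₁) ℤ.+ a ℤ.* b ℤ.* c ℤ.* (weight n ℤ.* v₀)
      ≡⟨ cong (λ w → P ℤ.* (w ℤ.* v₁) ℤ.+ Q ℤ.* lucas n) (coef-weight n) ⟩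
    P ℤ.* lucas (1 ℕ.+ n) ℤ.+ Q ℤ.* lucas n ∎
    where
    C  = coef a b (2 ℕ.+ n)
    v₁ = v a b c (1 ℕ.+ n)
    v₀ = v a b c n
    expand : ∀ a b c w C v₁ v₀ → a ℤ.* b ℤ.* w ℤ.* (C ℤ.* v₁ ℤ.+ c ℤ.* v₀)
                                 ≡ a ℤ.* b ℤ.* (C ℤ.* w ℤ.* v₁) ℤ.+ a ℤ.* b ℤ.* c ℤ.* (w ℤ.* v₀)
    expand = solve-∀

  open Zα-Ring a b c using (commutativeRing; _^_; emb-*)
  open CommutativeRing commutativeRing using (_+_)
  open PowerSums commutativeRing using (Recurrence; vieta⇒recurrence≈power-sum)

  emb-lucas≡power-sum : ∀ {z z̄} → z ⊕ z̄ ≡ emb P → z ⊗ z̄ ≡ emb (- Q) →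
                        ∀ n → emb (lucas n) ≡ z ^ n + z̄ ^ n
  emb-lucas≡power-sum z⊕z̄≡P z⊗z̄≡-Q =
    vieta⇒recurrence≈power-sum z⊕z̄≡P z⊗z̄≡-Q emb-lucas-recurrence ≡.refl (cong emb lucas-1)
    where
    emb-lucas-recurrence : Recurrence (emb P) (emb Q) (λ n → emb (lucas n))
    emb-lucas-recurrence n =
      ≡.trans (cong emb (lucas-recurrence n)) (cong₂ _⊕_ (emb-* P _) (emb-* Q _))

lemma3 : (a b c : ℤ) → + 0 ℤ.< a → + 0 ℤ.< b → + 0 ℤ.< c →
  (m r : ℕ) → 0 ℕ.< m → 0 ℕ.< r →
  (z : Zα) → (z ≡ Arith.α a b c ⊎ z ≡ Arith.β a b c) →
  let open Arith a b c
      t = - (a ℤ.* b ℤ.* c)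
  in ((⊖ emb (t ℤ.^ (m ℕ.+ r)))
       ⊕ (emb ((a ℤ.^ ((r ℕ.+ ξ r) ℕ./ 2)) ℤ.* (b ℤ.^ ((r ℕ.∸ ξ r) ℕ./ 2)) ℤ.* v a b c r ℤ.* (t ℤ.^ m)) ⊗ (z ⊛ r)))
       ⊕ (z ⊛ (2 ℕ.* (m ℕ.+ r)))
     ≡ (z ⊛ (m ℕ.+ 2 ℕ.* r)) ⊗ emb ((a ℤ.^ ((m ℕ.+ ξ m) ℕ./ 2)) ℤ.* (b ℤ.^ ((m ℕ.∸ ξ m) ℕ./ 2)) ℤ.* v a b c m)
lemma3 a b c _ _ _ m r _ _ z z-root with Zα-Ring.conjugate a b c z-root
... | z̄ , z⊕z̄≡P , z⊗z̄≡-Q = begin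
    ((⊖ emb (t ℤ.^ (m ℕ.+ r))) ⊕ (emb (lucas r ℤ.* t ℤ.^ m) ⊗ (z ⊛ r))) ⊕ (z ⊛ (2 ℕ.* (m ℕ.+ r)))
      ≡⟨ cong₂ _⊕_ (cong₂ _⊕_ (cong ⊖_ (emb-t^ (m ℕ.+ r))) (cong₂ _⊗_ emb-lucas-r-t^m (⊛≡^ z r)))
                   (⊛≡^ z (2 ℕ.* (m ℕ.+ r))) ⟩
    ⊖ ((z * z̄) ^ (m ℕ.+ r)) + (z ^ r + z̄ ^ r) * (z * z̄) ^ m * z ^ r + z ^ (2 ℕ.* (m ℕ.+ r))
      ≡⟨ power-sum-identity z z̄ m r ⟩
    z ^ (m ℕ.+ 2 ℕ.* r) * (z ^ m + z̄ ^ m)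
      ≡⟨ cong₂ _⊗_ (⊛≡^ z (m ℕ.+ 2 ℕ.* r)) (emb-lucas m) ⟨
    (z ⊛ (m ℕ.+ 2 ℕ.* r)) ⊗ emb (lucas m) ∎
  where
  open Arith a b c
  open Zα-Ring a b c
  open CommutativeRing commutativeRing using (_+_; _*_)
  open PowerSums commutativeRing using (power-sum-identity)
  open Lucas a b c using (lucas; emb-lucas≡power-sum)
  open ≡-Reasoning
  t : ℤ
  t = - Q
  emb-t^ : ∀ k → emb (t ℤ.^ k) ≡ (z * z̄) ^ k
  emb-t^ k = ≡.trans (emb-^ t k) (cong (_^ k) (≡.sym z⊗z̄≡-Q))
  emb-lucas : ∀ n → emb (lucas n) ≡ z ^ n + z̄ ^ n
  emb-lucas = emb-lucas≡power-sum z⊕z̄≡P z⊗z̄≡-Q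
  emb-lucas-r-t^m : emb (lucas r ℤ.* t ℤ.^ m) ≡ (z ^ r + z̄ ^ r) * (z * z̄) ^ m
  emb-lucas-r-t^m = ≡.trans (emb-* (lucas r) (t ℤ.^ m)) (cong₂ _⊗_ (emb-lucas r) (emb-t^ m))
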